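{- Let $r$ be a positive integer and $T$ a rooted tree. Then $\mathrm{Cyc}(r,\bullet)\otimes\{T\}\cong\mathrm{Cyc}(r,T)$.
   Context: Graphs are directed, with edges in trees pointing toward the root. $\bullet$ is the one-vertex tree, $\mathrm{Cyc}(r,\bullet)$ is a directed cycle of length $r$, and $\mathrm{Cyc}(r,T)$ is a graph consisting of a directed cycle of length $r$ each of whose vertices is the root of a copy of $T$. $\{T\}$ is $T$ with a loop added at its root. The tensor product $G_1\otimes G_2$ has vertex set $V_{G_1}\times V_{G_2}$ and an edge $(v_1,v_2)\to(w_1,w_2)$ iff $v_i\to w_i$ is an edge of $G_i$ for $i=1,2$. -}

module Defs where

open import Data.Nat using (ℕ; suc)
open import Data.Nat.DivMod using (_%_)
open import Data.Fin using (Fin; toℕ)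
open import Data.List using (List; length; lookup)
open import Data.Product using (_×_; _,_)
open import Data.Sum using (_⊎_)
open import Relation.Binary.PropositionalEquality using (_≡_)
open import Function.Bundles using (_↔_; Inverse)
open import Function using (_⇔_)

record Graph : Set₁ where
  field
    V : Set
    E : V → V → Set
open Graph public

record _≅_ (G H : Graph) : Set where
  field
    bij  : V G ↔ V H
  open Inverse bij public using (to)
  field
    edge : ∀ u v → E G u v ⇔ E H (to u) (to v)

_⊗_ : Graph → Graph → Graph
G ⊗ H = record
  { V = V G × V H
  ; E = λ { (v₁ , v₂) (w₁ , w₂) → E G v₁ w₁ × E H v₂ w₂ } }

data Tree : Set where
  node : List Tree → Tree

children : Tree → List Tree
children (node ts) = ts

data Pos : Tree → Set where
  root  : ∀ {t} → Pos t
  below : ∀ {t} (i : Fin (length (children t))) → Pos (lookup (children t) i) → Pos t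

-- Edges of a rooted tree, oriented toward the root (each child root points to its parent).
data TEdge : (t : Tree) → Pos t → Pos t → Set where
  up   : ∀ {t} (i : Fin (length (children t))) → TEdge t (below i root) root
  deep : ∀ {t} (i : Fin (length (children t))) {p q} →
         TEdge (lookup (children t) i) p q → TEdge t (below i p) (below i q)

TreeG : Tree → Graph
TreeG t = record { V = Pos t ; E = TEdge t }

-- {T}: T with a loop added at its root.
loopRoot : Tree → Graph
loopRoot t = record
  { V = Pos t
  ; E = λ u v → TEdge t u v ⊎ (u ≡ root × v ≡ root) }

CycE : (n : ℕ) → Fin (suc n) → Fin (suc n) → Set
CycE n i j = toℕ j ≡ suc (toℕ i) % suc n

-- Cyc(r,•) with r = suc n.
CycDot : (n : ℕ) → Graph
CycDot n = record { V = Fin (suc n) ; E = CycE n }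

-- Cyc(r,T) with r = suc n: a directed cycle of length r, each vertex the root of a copy of T.
CycT : (n : ℕ) → Tree → Graph
CycT n t = record
  { V = Fin (suc n) × Pos t
  ; E = λ { (i , p) (j , q) →
            (i ≡ j × TEdge t p q) ⊎ (p ≡ root × q ≡ root × CycE n i j) } }

{-# OPTIONS --safe #-}
-- Send (i , p) to (i + depth p , p). A tensor edge (i , p) → (i + 1 , q) either follows a
-- tree edge p → q, along which the depth drops by one, so the cycle coordinate i + depth p
-- is preserved and the edge stays inside one copy of T; or it uses the loop at the root,
-- where the depth is 0 and the edge becomes the cycle edge between consecutive roots.
module Submission where

open import Defs
open import Data.Nat using (ℕ; suc; zero; s≤s)
open import Data.Nat.DivMod using (_%_; m%n<n; n%n≡0; m<n⇒m%n≡m)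
open import Data.Fin using (Fin; toℕ; fromℕ<; fromℕ; inject₁) renaming (zero to fz; suc to fs)
open import Data.Fin.Properties using (toℕ-injective; toℕ-fromℕ<; toℕ-fromℕ; toℕ-inject₁; toℕ<n)
open import Data.Product using (_×_; _,_)
open import Data.Sum using (inj₁; inj₂)
open import Function using (_↔_; Inverse; Injection; mk↔ₛ′; mk⇔)
open import Function.Properties.Inverse using (↔-refl; ↔-trans; ↔⇒↣)
open import Relation.Binary.PropositionalEquality

module _ {a} {A : Set a} where
  open Inverse

  infixr 8 _^↔_

  _^↔_ : A ↔ A → ℕ → A ↔ A
  σ ^↔ zero  = ↔-refl
  σ ^↔ suc k = ↔-trans σ (σ ^↔ k)

  ^↔-suc-injective : ∀ (σ : A ↔ A) k {x y} →
                     to (σ ^↔ suc k) x ≡ to (σ ^↔ k) y → to σ x ≡ y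
  ^↔-suc-injective σ k = Injection.injective (↔⇒↣ (σ ^↔ k))

module _ {a b} {A : Set a} {B : Set b} where
  open Inverse

  ×-twist↔ : (B → A ↔ A) → (A × B) ↔ (A × B)
  ×-twist↔ φ = mk↔ₛ′ (λ (x , p) → to (φ p) x , p) (λ (x , p) → from (φ p) x , p)
                     (λ (x , p) → cong (_, p) (strictlyInverseˡ (φ p) x))
                     (λ (x , p) → cong (_, p) (strictlyInverseʳ (φ p) x))

data LastOrInject : ∀ {m} → Fin (suc m) → Set where
  last   : ∀ {m} → LastOrInject (fromℕ m)
  inject : ∀ {m} (j : Fin m) → LastOrInject (inject₁ j)

lastOrInject : ∀ {m} (i : Fin (suc m)) → LastOrInject i
lastOrInject {zero}  fz     = last
lastOrInject {suc m} fz     = inject fz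
lastOrInject {suc m} (fs i) with lastOrInject i
... | last     = last
... | inject j = inject (fs j)

module _ {n : ℕ} where

  next : Fin (suc n) → Fin (suc n)
  next i = fromℕ< (m%n<n (suc (toℕ i)) (suc n))

  prev : Fin (suc n) → Fin (suc n)
  prev fz     = fromℕ n
  prev (fs j) = inject₁ j

  toℕ-next : ∀ i → toℕ (next i) ≡ suc (toℕ i) % suc n
  toℕ-next i = toℕ-fromℕ< (m%n<n (suc (toℕ i)) (suc n))

  next-fromℕ : next (fromℕ n) ≡ fz
  next-fromℕ = toℕ-injective (begin
    toℕ (next (fromℕ n))        ≡⟨ toℕ-next (fromℕ n) ⟩
    suc (toℕ (fromℕ n)) % suc n ≡⟨ cong (λ k → suc k % suc n) (toℕ-fromℕ n) ⟩
    suc n % suc n               ≡⟨ n%n≡0 (suc n) ⟩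
    0                           ∎)
    where open ≡-Reasoning

  next-inject₁ : ∀ j → next (inject₁ j) ≡ fs j
  next-inject₁ j = toℕ-injective (begin
    toℕ (next (inject₁ j))        ≡⟨ toℕ-next (inject₁ j) ⟩
    suc (toℕ (inject₁ j)) % suc n ≡⟨ cong (λ k → suc k % suc n) (toℕ-inject₁ j) ⟩
    suc (toℕ j) % suc n           ≡⟨ m<n⇒m%n≡m (s≤s (toℕ<n j)) ⟩
    suc (toℕ j)                   ∎)
    where open ≡-Reasoning

  next-prev : ∀ i → next (prev i) ≡ i
  next-prev fz     = next-fromℕ
  next-prev (fs j) = next-inject₁ j

  prev-next : ∀ i → prev (next i) ≡ i
  prev-next i with lastOrInject i
  ... | last     = cong prev next-fromℕ
  ... | inject j = cong prev (next-inject₁ j)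

  rotate : Fin (suc n) ↔ Fin (suc n)
  rotate = mk↔ₛ′ next prev next-prev prev-next

  CycE⇒next : ∀ {i j} → CycE n i j → next i ≡ j
  CycE⇒next {i} c = toℕ-injective (trans (toℕ-next i) (sym c))

  next⇒CycE : ∀ {i j} → next i ≡ j → CycE n i j
  next⇒CycE {i} refl = toℕ-next i

depth : ∀ {t} → Pos t → ℕ
depth root        = zero
depth (below i p) = suc (depth p)

depth-edge : ∀ {t p q} → TEdge t p q → depth p ≡ suc (depth q)
depth-edge (up i)     = refl
depth-edge (deep i e) = cong suc (depth-edge e)

lemma3p5 : (n : ℕ) (T : Tree) → (CycDot n ⊗ loopRoot T) ≅ CycT n T
lemma3p5 n T = record { bij = twist ; edge = λ u v → mk⇔ (forth u v) (back u v) }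
  where
  open Inverse

  shift : ℕ → Fin (suc n) → Fin (suc n)
  shift k = to (rotate ^↔ k)

  twist : (Fin (suc n) × Pos T) ↔ (Fin (suc n) × Pos T)
  twist = ×-twist↔ (λ p → rotate ^↔ depth p)

  shift-edge : ∀ {p q} x → TEdge T p q → shift (depth p) x ≡ shift (depth q) (next x)
  shift-edge x e = cong (λ k → shift k x) (depth-edge e)

  forth : ∀ u v → E (CycDot n ⊗ loopRoot T) u v → E (CycT n T) (to twist u) (to twist v)
  forth (x , p) (y , q) (c , inj₁ e) =
    inj₁ (trans (shift-edge x e) (cong (shift (depth q)) (CycE⇒next c)) , e)
  forth (x , _) (y , _) (c , inj₂ (refl , refl)) = inj₂ (refl , refl , c)

  back : ∀ u v → E (CycT n T) (to twist u) (to twist v) → E (CycDot n ⊗ loopRoot T) u v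
  back (x , p) (y , q) (inj₁ (eq , e)) =
    next⇒CycE (^↔-suc-injective rotate (depth q) (trans (sym (shift-edge x e)) eq)) , inj₁ e
  back (x , _) (y , _) (inj₂ (refl , refl , c)) = c , inj₂ (refl , refl)
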